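{- Let $p$ be a prime. Then for every $n \in \mathbb{N}$ there exist finitely many $d_1, \dots, d_k \in \mathbb{N}$ such that $n \equiv \prod_{i=1}^{k} \binom{2d_i}{d_i} \pmod p$. -}

module Defs where

open import Data.Nat using (ℕ; _*_)
open import Data.Nat.Combinatorics using (_C_)
open import Data.List using (List; map)
open import Data.Nat.ListAction using (product)
open import Data.Integer using (ℤ; +_; _-_)
open import Data.Integer.Divisibility using (_∣_)

centralBinom : ℕ → ℕ
centralBinom d = (2 * d) C d

_≡_[mod_] : ℕ → ℕ → ℕ → Set
a ≡ b [mod m ] = (+ m) ∣ ((+ a) - (+ b))

module Submission where

-- Fix a prime p and call n ∈ ℕ *representable* if n is congruent
-- mod p to a product of central binomial coefficients C(2d,d).  Representable
-- numbers contain 1 and are closed under multiplication; by a pigeonhole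
-- argument on powers they are also closed under division by representable
-- numbers prime to p.  Two facts about C(2d,d) then finish the proof:
--   * p ∣ C(2d,d) when d < p ≤ 2d, and p ∤ C(2d,d) when 2d < p
--     (compare p-divisibility in  C(2d,d)·d!·d! = (2d)!);
--   * (d+1)·C(2d+2,d+1) = 2(2d+1)·C(2d,d).
-- So 0 ≡ C(2(p-1),p-1) is representable, and every 0 < k < p is, by strong
-- induction: k = 1 is the empty product, an even k is 2·(k/2) with 2 = C(2,1),
-- and an odd k = 2D+1 ≥ 3 satisfies k·(2·C(2D,D)) = (D+1)·C(2D+2,D+1), where
-- 2·C(2D,D) is prime to p.  Every n is congruent to its residue n % p < p.

open import Defs
open import Data.Nat
  using (ℕ; zero; suc; _+_; _*_; _∸_; _^_; _<_; _≤_; _!; z≤n; s≤s; s≤s⁻¹; NonZero; nonTrivial⇒n>1; _%_; _/_)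
open import Data.Nat.Properties
open import Data.Nat.Combinatorics using (_C_; nCk≡n!/k![n-k]!; k![n∸k]!∣n!)
open import Data.Nat.Divisibility
  using (_∣_; _∤_; ∣-trans; m∣m*n; n∣m*n; ∣m⇒∣m*n; m≤n⇒m!∣n!; >⇒∤)
open import Data.Nat.DivMod using (m/n*n≡m; m≡m%n+[m/n]*n; m%n<n; m%n≤m)
open import Data.Nat.Primality using (Prime; euclidsLemma; prime⇒nonZero; prime⇒nonTrivial; ¬prime[0])
open import Data.Nat.Induction using (<-rec)
open import Data.Nat.ListAction using (product)
open import Data.Nat.ListAction.Properties using (product-++)
import Data.Nat.Tactic.RingSolver as ℕ-Solver
import Data.Integer as ℤ
open import Data.Integer using (ℤ; +_; _-_)
import Data.Integer.Properties as ℤ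
import Data.Integer.Divisibility.Signed as ℤ∣
import Data.Integer.Tactic.RingSolver as ℤ-Solver
open import Data.Fin using (Fin; toℕ; fromℕ<)
open import Data.Fin.Properties using (pigeonhole; toℕ-fromℕ<)
open import Data.List using (List; []; _∷_; _++_; map)
open import Data.List.Properties using (map-++)
open import Data.Product using (∃; _,_)
open import Data.Empty using (⊥-elim)
open import Data.Sum using (inj₁; inj₂; [_,_]′; fromInj₁)
open import Function using (_∘_)
open import Relation.Binary.Bundles using (Setoid)
open import Relation.Binary.PropositionalEquality
  using (_≡_; refl; sym; trans; cong; cong₂; subst; module ≡-Reasoning)

2*suc : ∀ m → 2 * suc m ≡ suc (suc (2 * m))
2*suc = ℕ-Solver.solve-∀

binomial-factorial : ∀ {n k} → k ≤ n → (n C k) * (k ! * (n ∸ k) !) ≡ n !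
binomial-factorial {n} {k} k≤n = begin
  (n C k) * (k ! * (n ∸ k) !)                    ≡⟨ cong (_* (k ! * (n ∸ k) !)) (nCk≡n!/k![n-k]! k≤n) ⟩
  n ! / (k ! * (n ∸ k) !) * (k ! * (n ∸ k) !)    ≡⟨ m/n*n≡m (k![n∸k]!∣n! k≤n) ⟩
  n !                                            ∎
  where
  open ≡-Reasoning
  instance _ = k !* (n ∸ k) !≢0

centralBinom-factorial : ∀ d → centralBinom d * (d ! * d !) ≡ (2 * d) !
centralBinom-factorial d =
  subst (λ e → centralBinom d * (d ! * e !) ≡ (2 * d) !) 2d∸d≡d
        (binomial-factorial (m≤m+n d (d + 0)))
  where
  2d∸d≡d : 2 * d ∸ d ≡ d
  2d∸d≡d = trans (m+n∸m≡n d (d + 0)) (+-identityʳ d)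

-- Consecutive central binomial coefficients: (d+1)·C(2d+2,d+1) = 2(2d+1)·C(2d,d).
-- Both sides times d!·d!·(d+1) equal (2d+2)!.
centralBinom-suc : ∀ d → suc d * centralBinom (suc d) ≡ 2 * suc (2 * d) * centralBinom d
centralBinom-suc d = *-cancelʳ-≡ _ _ (suc d * (d ! * d !)) (begin
  suc d * c′ * (suc d * (d ! * d !))                  ≡⟨ regroup (suc d) c′ (d !) ⟩
  c′ * (suc d ! * suc d !)                            ≡⟨ centralBinom-factorial (suc d) ⟩
  (2 * suc d) !                                       ≡⟨ cong _! (2*suc d) ⟩
  suc (suc (2 * d)) * (suc (2 * d) * (2 * d) !)       ≡⟨ cong (λ e → suc (suc (2 * d)) * (suc (2 * d) * e))
                                                              (sym (centralBinom-factorial d)) ⟩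
  suc (suc (2 * d)) * (suc (2 * d) * (c * (d ! * d !))) ≡⟨ expand d c (d !) ⟩
  2 * suc (2 * d) * c * (suc d * (d ! * d !))         ∎)
  where
  open ≡-Reasoning
  c = centralBinom d
  c′ = centralBinom (suc d)
  instance _ = m*n≢0 (suc d) (d ! * d !) {{_}} {{d !* d !≢0}}
  regroup : ∀ s b f → s * b * (s * (f * f)) ≡ b * ((s * f) * (s * f))
  regroup = ℕ-Solver.solve-∀
  expand : ∀ d b f → suc (suc (2 * d)) * (suc (2 * d) * (b * (f * f)))
                     ≡ 2 * suc (2 * d) * b * (suc d * (f * f))
  expand = ℕ-Solver.solve-∀

∣! : ∀ {m n} → .{{NonZero m}} → m ≤ n → m ∣ n !
∣! {suc m} m≤n = ∣-trans (m∣m*n (m !)) (m≤n⇒m!∣n! m≤n)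

prime∤1 : ∀ {p} → Prime p → p ∤ 1
prime∤1 {p} p-prime = >⇒∤ (nonTrivial⇒n>1 p {{prime⇒nonTrivial p-prime}})

prime∤! : ∀ {p} → Prime p → ∀ {n} → n < p → p ∤ n !
prime∤! p-prime {zero} _ = prime∤1 p-prime
prime∤! p-prime {suc n} n<p p∣ with euclidsLemma (suc n) (n !) p-prime p∣
... | inj₁ p∣1+n = >⇒∤ n<p p∣1+n
... | inj₂ p∣n!  = prime∤! p-prime (<-trans (n<1+n n) n<p) p∣n!

-- A prime p divides C(2d,d) when d < p ≤ 2d: it divides (2d)! but not d!·d!.
prime∣centralBinom : ∀ {p d} → Prime p → d < p → p ≤ 2 * d → p ∣ centralBinom d
prime∣centralBinom {p} {d} p-prime d<p p≤2d =
  fromInj₁ (⊥-elim ∘ p∤d!·d!) (euclidsLemma (centralBinom d) (d ! * d !) p-prime p∣c·d!·d!)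
  where
  instance _ = prime⇒nonZero p-prime
  p∣c·d!·d! : p ∣ centralBinom d * (d ! * d !)
  p∣c·d!·d! = subst (p ∣_) (sym (centralBinom-factorial d)) (∣! p≤2d)
  p∤d! : p ∤ d !
  p∤d! = prime∤! p-prime d<p
  p∤d!·d! : p ∤ d ! * d !
  p∤d!·d! p∣d!·d! = [ p∤d! , p∤d! ]′ (euclidsLemma (d !) (d !) p-prime p∣d!·d!)

-- A prime p does not divide C(2d,d) when 2d < p, since it does not divide (2d)!.
prime∤centralBinom : ∀ {p d} → Prime p → 2 * d < p → p ∤ centralBinom d
prime∤centralBinom {p} {d} p-prime 2d<p p∣c =
  prime∤! p-prime 2d<p (subst (p ∣_) (centralBinom-factorial d) (∣m⇒∣m*n (d ! * d !) p∣c))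

-- In particular p divides C(2(p−1), p−1), as p − 1 < p ≤ 2(p − 1).
prime∣centralBinom[p-1] : ∀ {p} → Prime p → p ∣ centralBinom (p ∸ 1)
prime∣centralBinom[p-1] {zero} p-prime = ⊥-elim (¬prime[0] p-prime)
prime∣centralBinom[p-1] {suc q} p-prime =
  prime∣centralBinom p-prime (n<1+n q) (m<m+n q (≤-trans 0<q (m≤m+n q 0)))
  where
  0<q : 0 < q
  0<q = s≤s⁻¹ (nonTrivial⇒n>1 (suc q) {{prime⇒nonTrivial p-prime}})

data Parity : ℕ → Set where
  even : ∀ m → Parity (2 * m)
  odd  : ∀ m → Parity (suc (2 * m))

parity : ∀ n → Parity n
parity zero = even 0
parity (suc n) with parity n
... | even m = odd m
... | odd m  = subst Parity (2*suc m) (even (suc m))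

module Congruence (m : ℕ) where

  -- a ≈ b wraps  a ≡ b [mod m ]  in a record so that a and b can be read off
  -- its type (the underlying divisibility statement does not determine them).
  infix 4 _≈_
  record _≈_ (a b : ℕ) : Set where
    constructor mod
    field unmod : a ≡ b [mod m ]
  open _≈_ public

  ∣-difference : ∀ {a b z} → + m ℤ∣.∣ z → + a - + b ≡ z → a ≈ b
  ∣-difference m∣z a-b≡z = mod (ℤ∣.∣⇒∣ᵤ (subst (ℤ∣._∣_ (+ m)) (sym a-b≡z) m∣z))

  signed : ∀ {a b} → a ≈ b → + m ℤ∣.∣ (+ a - + b)
  signed {a} {b} (mod m∣a-b) = ℤ∣.∣ᵤ⇒∣ {+ m} {+ a - + b} m∣a-b

  ≈-refl : ∀ {a} → a ≈ a
  ≈-refl {a} = ∣-difference (ℤ∣.divides (+ 0) refl) (ℤ.+-inverseʳ (+ a))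

  ≈-sym : ∀ {a b} → a ≈ b → b ≈ a
  ≈-sym {a} {b} (mod m∣a-b) = mod (subst (m ∣_) (ℤ.∣i-j∣≡∣j-i∣ (+ a) (+ b)) m∣a-b)

  ≈-trans : ∀ {a b c} → a ≈ b → b ≈ c → a ≈ c
  ≈-trans {a} {b} {c} a≈b b≈c =
    ∣-difference (ℤ∣.∣m∣n⇒∣m+n (signed a≈b) (signed b≈c)) (telescope (+ a) (+ b) (+ c))
    where
    telescope : ∀ x y z → x - z ≡ (x - y) ℤ.+ (y - z)
    telescope = ℤ-Solver.solve-∀

  ≈-setoid : Setoid _ _
  ≈-setoid = record
    { Carrier = ℕ ; _≈_ = _≈_
    ; isEquivalence = record { refl = ≈-refl ; sym = ≈-sym ; trans = ≈-trans } }

  ≡⇒≈ : ∀ {a b} → a ≡ b → a ≈ b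
  ≡⇒≈ refl = ≈-refl

  *-cong : ∀ {a b c d} → a ≈ b → c ≈ d → a * c ≈ b * d
  *-cong {a} {b} {c} {d} a≈b c≈d =
    ∣-difference (ℤ∣.∣m∣n⇒∣m+n (ℤ∣.∣n⇒∣m*n (+ a) (signed c≈d)) (ℤ∣.∣m⇒∣m*n (+ d) (signed a≈b)))
      (begin
        + (a * c) - + (b * d)             ≡⟨ cong₂ _-_ (ℤ.pos-* a c) (ℤ.pos-* b d) ⟩
        + a ℤ.* + c - + b ℤ.* + d         ≡⟨ split (+ a) (+ b) (+ c) (+ d) ⟩
        + a ℤ.* (+ c - + d) ℤ.+ (+ a - + b) ℤ.* + d ∎)
    where
    open ≡-Reasoning
    split : ∀ x y u v → x ℤ.* u - y ℤ.* v ≡ x ℤ.* (u - v) ℤ.+ (x - y) ℤ.* v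
    split = ℤ-Solver.solve-∀

  ∣⇒≈0 : ∀ {a} → m ∣ a → a ≈ 0
  ∣⇒≈0 {a} m∣a = mod (subst (m ∣_) (sym (+-identityʳ a)) m∣a)

  module _ .{{_ : NonZero m}} where

    %-≈ : ∀ a → a % m ≈ a
    %-≈ a = mod (subst (m ∣_) (sym ∣r-a∣≡q*m) (n∣m*n (a / m)))
      where
      open ≡-Reasoning
      r = a % m
      ∣r-a∣≡q*m : ℤ.∣ + r - + a ∣ ≡ a / m * m
      ∣r-a∣≡q*m = begin
        ℤ.∣ + r - + a ∣        ≡⟨ cong ℤ.∣_∣ (ℤ.[+m]-[+n]≡m⊖n r a) ⟩
        ℤ.∣ r ℤ.⊖ a ∣          ≡⟨ ℤ.∣⊖∣-≤ (m%n≤m a m) ⟩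
        a ∸ r                  ≡⟨ cong (_∸ r) (m≡m%n+[m/n]*n a m) ⟩
        r + a / m * m ∸ r      ≡⟨ m+n∸m≡n r (a / m * m) ⟩
        a / m * m              ∎

    %-≡⇒≈ : ∀ {a b} → a % m ≡ b % m → a ≈ b
    %-≡⇒≈ {a} {b} same = ≈-trans (≈-sym (%-≈ a)) (subst (_≈ b) (sym same) (%-≈ b))

module PrimeModulus {p : ℕ} (p-prime : Prime p) where

  open Congruence p

  private instance
    p≢0 : NonZero p
    p≢0 = prime⇒nonZero p-prime

  prime∤^ : ∀ {y} → p ∤ y → ∀ n → p ∤ y ^ n
  prime∤^ p∤y zero = prime∤1 p-prime
  prime∤^ {y} p∤y (suc n) p∣ with euclidsLemma y (y ^ n) p-prime p∣
  ... | inj₁ p∣y   = p∤y p∣y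
  ... | inj₂ p∣y^n = prime∤^ p∤y n p∣y^n

  *-cancelˡ-≈ : ∀ {c a b} → p ∤ c → c * a ≈ c * b → a ≈ b
  *-cancelˡ-≈ {c} {a} {b} p∤c (mod p∣ca-cb) with euclidsLemma c (ℤ.∣ + a - + b ∣) p-prime
    (subst (p ∣_) ∣ca-cb∣≡c∣a-b∣ p∣ca-cb)
    where
    open ≡-Reasoning
    factor : ∀ x y z → x ℤ.* y - x ℤ.* z ≡ x ℤ.* (y - z)
    factor = ℤ-Solver.solve-∀
    ∣ca-cb∣≡c∣a-b∣ : ℤ.∣ + (c * a) - + (c * b) ∣ ≡ c * ℤ.∣ + a - + b ∣
    ∣ca-cb∣≡c∣a-b∣ = begin
      ℤ.∣ + (c * a) - + (c * b) ∣        ≡⟨ cong ℤ.∣_∣ (cong₂ _-_ (ℤ.pos-* c a) (ℤ.pos-* c b)) ⟩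
      ℤ.∣ + c ℤ.* + a - + c ℤ.* + b ∣    ≡⟨ cong ℤ.∣_∣ (factor (+ c) (+ a) (+ b)) ⟩
      ℤ.∣ + c ℤ.* (+ a - + b) ∣          ≡⟨ ℤ.abs-* (+ c) (+ a - + b) ⟩
      c * ℤ.∣ + a - + b ∣                ∎
  ... | inj₁ p∣c   = ⊥-elim (p∤c p∣c)
  ... | inj₂ p∣a-b = mod p∣a-b

  residue : ℕ → Fin p
  residue a = fromℕ< (m%n<n a p)

  residue-≡⇒≈ : ∀ {a b} → residue a ≡ residue b → a ≈ b
  residue-≡⇒≈ {a} {b} eq = %-≡⇒≈
    (trans (sym (toℕ-fromℕ< (m%n<n a p))) (trans (cong toℕ eq) (toℕ-fromℕ< (m%n<n b p))))

  -- Every y prime to p has an inverse among its powers (a weak Fermat theorem):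
  -- two of y⁰, …, yᵖ share a residue, say yⁱ ≈ yⁱ⁺¹⁺ᵒ, and yⁱ cancels.
  inverse : ∀ {y} → p ∤ y → ∃ λ o → y * y ^ o ≈ 1
  inverse {y} p∤y with pigeonhole (n<1+n p) (λ i → residue (y ^ toℕ i))
  ... | i , j , i<j , same-residue with m≤n⇒∃[o]m+o≡n i<j
  ... | o , 1+i+o≡j = o , *-cancelˡ-≈ (prime∤^ p∤y (toℕ i)) (begin
    y ^ toℕ i * (y * y ^ o)  ≡⟨ ^-distribˡ-+-* y (toℕ i) (suc o) ⟨
    y ^ (toℕ i + suc o)      ≡⟨ cong (y ^_) (trans (+-suc (toℕ i) o) 1+i+o≡j) ⟩
    y ^ toℕ j                ≈⟨ residue-≡⇒≈ same-residue ⟨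
    y ^ toℕ i                ≡⟨ *-identityʳ (y ^ toℕ i) ⟨
    y ^ toℕ i * 1            ∎)
    where open import Relation.Binary.Reasoning.Setoid ≈-setoid

module Representability {p : ℕ} (p-prime : Prime p) where

  open Congruence p
  open PrimeModulus p-prime

  centralProduct : List ℕ → ℕ
  centralProduct ds = product (map centralBinom ds)

  centralProduct-++ : ∀ ds es → centralProduct (ds ++ es) ≡ centralProduct ds * centralProduct es
  centralProduct-++ ds es =
    trans (cong product (map-++ centralBinom ds es)) (product-++ (map centralBinom ds) (map centralBinom es))

  Representable : ℕ → Set
  Representable n = ∃ λ ds → n ≈ centralProduct ds

  rep-1 : Representable 1
  rep-1 = [] , ≈-refl

  rep-centralBinom : ∀ d → Representable (centralBinom d)
  rep-centralBinom d = d ∷ [] , ≡⇒≈ (sym (*-identityʳ (centralBinom d)))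

  rep-≈ : ∀ {a b} → a ≈ b → Representable b → Representable a
  rep-≈ a≈b (ds , b≈ds) = ds , ≈-trans a≈b b≈ds

  rep-* : ∀ {a b} → Representable a → Representable b → Representable (a * b)
  rep-* (ds , a≈ds) (es , b≈es) =
    ds ++ es , ≈-trans (*-cong a≈ds b≈es) (≡⇒≈ (sym (centralProduct-++ ds es)))

  rep-^ : ∀ {y} → Representable y → ∀ n → Representable (y ^ n)
  rep-^ rep-y zero    = rep-1
  rep-^ rep-y (suc n) = rep-* rep-y (rep-^ rep-y n)

  -- Division by a representable number prime to p: x ≈ (x·y)·yᵒ, where yᵒ
  -- is the inverse of y.
  rep-÷ : ∀ {x y} → Representable y → p ∤ y → Representable (x * y) → Representable x
  rep-÷ {x} {y} rep-y p∤y rep-xy = divide (inverse p∤y)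
    where
    open import Relation.Binary.Reasoning.Setoid ≈-setoid
    divide : (∃ λ o → y * y ^ o ≈ 1) → Representable x
    divide (o , y·yᵒ≈1) = rep-≈ x≈xy·yᵒ (rep-* rep-xy (rep-^ rep-y o))
      where
      x≈xy·yᵒ : x ≈ x * y * y ^ o
      x≈xy·yᵒ = begin
        x                ≡⟨ *-identityʳ x ⟨
        x * 1            ≈⟨ *-cong (≈-refl {x}) y·yᵒ≈1 ⟨
        x * (y * y ^ o)  ≡⟨ *-assoc x y (y ^ o) ⟨
        x * y * y ^ o    ∎

  -- 0 is representable, as p divides C(2(p−1), p−1).
  rep-0 : Representable 0
  rep-0 = rep-≈ (≈-sym (∣⇒≈0 (prime∣centralBinom[p-1] p-prime))) (rep-centralBinom (p ∸ 1))

  -- Every 0 < k < p is representable, by strong induction on k: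
  --   2m = C(2,1)·m,  1 = empty product,  and for k = 2D + 1 with D ≥ 1,
  --   k·(2·C(2D,D)) = C(2D+2,D+1)·(D+1)  where 2·C(2D,D) is prime to p.
  rep-positive : ∀ k → 0 < k → k < p → Representable k
  rep-positive = <-rec (λ k → 0 < k → k < p → Representable k) step
    where
    step : ∀ k → (∀ {j} → j < k → 0 < j → j < p → Representable j) → 0 < k → k < p → Representable k
    step k ih 0<k k<p with parity k
    ... | even zero    = ⊥-elim (n≮0 0<k)
    ... | even (suc m) = rep-* (rep-centralBinom 1) (ih m+1<k (s≤s z≤n) (<-trans m+1<k k<p))
      where
      m+1<k : suc m < 2 * suc m
      m+1<k = m<m+n (suc m) (s≤s z≤n)
    ... | odd zero = rep-1
    ... | odd (suc d) =
      rep-÷ rep-2c p∤2c (rep-≈ (≡⇒≈ k·2c≡c′·[D+1]) (rep-* (rep-centralBinom (suc D)) rep-D+1))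
      where
      D = suc d
      c = centralBinom D
      2D<p : 2 * D < p
      2D<p = <-trans (n<1+n (2 * D)) k<p
      D+1<k : suc D < suc (2 * D)
      D+1<k = s≤s (m<m+n D (s≤s z≤n))
      rep-D+1 : Representable (suc D)
      rep-D+1 = ih D+1<k (s≤s z≤n) (<-trans D+1<k k<p)
      rep-2c : Representable (2 * c)
      rep-2c = rep-* (rep-centralBinom 1) (rep-centralBinom D)
      p∤2c : p ∤ 2 * c
      p∤2c p∣2c with euclidsLemma 2 c p-prime p∣2c
      ... | inj₁ p∣2 = >⇒∤ (≤-<-trans (*-monoʳ-≤ 2 (s≤s (z≤n {d}))) 2D<p) p∣2
      ... | inj₂ p∣c = prime∤centralBinom {d = D} p-prime 2D<p p∣c
      k·2c≡c′·[D+1] : suc (2 * D) * (2 * c) ≡ centralBinom (suc D) * suc D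
      k·2c≡c′·[D+1] = begin
        suc (2 * D) * (2 * c)        ≡⟨ swap (suc (2 * D)) c ⟩
        2 * suc (2 * D) * c          ≡⟨ centralBinom-suc D ⟨
        suc D * centralBinom (suc D) ≡⟨ *-comm (suc D) (centralBinom (suc D)) ⟩
        centralBinom (suc D) * suc D ∎
        where
        open ≡-Reasoning
        swap : ∀ k c → k * (2 * c) ≡ 2 * k * c
        swap = ℕ-Solver.solve-∀

  -- Every number is representable: it is congruent to its remainder n % p < p.
  rep-all : ∀ n → Representable n
  rep-all n = rep-≈ (≈-sym (%-≈ n)) (rep-below (n % p) (m%n<n n p))
    where
    instance _ = prime⇒nonZero p-prime
    rep-below : ∀ r → r < p → Representable r
    rep-below zero    _   = rep-0
    rep-below (suc r) r<p = rep-positive (suc r) (s≤s z≤n) r<p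

corollary2 : (p : ℕ) → Prime p → (n : ℕ) →
    ∃ λ (ds : List ℕ) → n ≡ product (map centralBinom ds) [mod p ]
corollary2 p p-prime n with Representability.rep-all p-prime n
... | ds , n≈ds = ds , unmod n≈ds
  where open Congruence p using (unmod)
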